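{- Let $n\ge 2$ and $m\ge 2$ be integers. Then (1) $H(\mu(S_n),x)=(4n+1)\,x+(2n^2+n+2)\,x^2$; (2) $H(\mu(K_{n,m}),x)=(3nm+n+m)\,x+(2n^2+2m^2+nm)\,x^2$.
   Context: $S_n$ denotes the star graph with one center vertex adjacent to $n$ leaves (so $n+1$ vertices and $n$ edges); $K_{n,m}$ is the complete bipartite graph with parts of sizes $n$ and $m$. For a graph $G$ and integer $k\ge1$, $d(G,k)$ is the number of unordered pairs of distinct vertices at distance exactly $k$, and the Hosoya polynomial of $G$ (of diameter $D$) is $H(G,x)=\sum_{k=1}^{D} d(G,k)x^k$. The Mycielskian graph $\mu(G)$ of a graph $G$ with vertex set $\{v_1,\dots,v_n\}$ has vertex set $\{v_1,\dots,v_n,u_1,\dots,u_n,w\}$ and edge set $E(G)\cup\{wu_i : 1\le i\le n\}\cup\{u_iv_j,\ u_jv_i : v_iv_j\in E(G)\}$. -}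

module Defs where

open import Data.Nat using (ℕ; zero; suc; _+_; _*_; _≤_; _<_)
open import Data.Bool using (Bool; true; false; _∧_; _∨_; not; _xor_; if_then_else_)
open import Data.Fin using (Fin; zero; suc; toℕ; splitAt)
import Data.Fin as F
open import Data.Sum using (_⊎_; inj₁; inj₂)
open import Data.List using (List; []; _∷_; allFin)
open import Relation.Nullary.Decidable using (⌊_⌋)
import Data.Nat as N

record Graph : Set where
  field
    V   : ℕ
    adj : Fin V → Fin V → Bool
open Graph public

anyL : {A : Set} → (A → Bool) → List A → Bool
anyL p []       = false
anyL p (x ∷ xs) = p x ∨ anyL p xs

countL : {A : Set} → (A → Bool) → List A → ℕ
countL p []       = 0
countL p (x ∷ xs) = (if p x then 1 else 0) + countL p xs

-- within G k u v : there is a walk of length at most k from u to v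
-- (equivalently: the distance from u to v is ≤ k).
within : (G : Graph) → ℕ → Fin (V G) → Fin (V G) → Bool
within G zero    u v = ⌊ u F.≟ v ⌋
within G (suc k) u v = within G k u v ∨ anyL (λ w → adj G u w ∧ within G k w v) (allFin (V G))

atDist : (G : Graph) → ℕ → Fin (V G) → Fin (V G) → Bool
atDist G zero    u v = ⌊ u F.≟ v ⌋
atDist G (suc k) u v = within G (suc k) u v ∧ not (within G k u v)

-- d(G,k): number of unordered pairs {u,v} of distinct vertices at distance exactly k
-- (each unordered pair counted once, as the ordered pair with toℕ u < toℕ v).
sumL : {A : Set} → (A → ℕ) → List A → ℕ
sumL f []       = 0
sumL f (x ∷ xs) = f x + sumL f xs

dG : (G : Graph) → ℕ → ℕ
dG G k = sumL (λ u → countL (λ v → ⌊ toℕ u N.<? toℕ v ⌋ ∧ atDist G k u v) (allFin (V G))) (allFin (V G))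

-- Coefficient of x^k in the Hosoya polynomial H(G,x) = Σ_{k=1}^{D} d(G,k) x^k
-- (the constant coefficient is 0; for k > D, d(G,k) = 0 automatically).
hosoyaCoeff : Graph → ℕ → ℕ
hosoyaCoeff G zero    = 0
hosoyaCoeff G (suc k) = dG G (suc k)

linQuad : ℕ → ℕ → ℕ → ℕ
linQuad a b 1 = a
linQuad a b 2 = b
linQuad a b _ = 0

star : ℕ → Graph
star n = record { V = suc n ; adj = a }
  where
    a : Fin (suc n) → Fin (suc n) → Bool
    a zero    zero    = false
    a zero    (suc _) = true
    a (suc _) zero    = true
    a (suc _) (suc _) = false

side : (n m : ℕ) → Fin (n + m) → Bool
side n m i with splitAt n i
... | inj₁ _ = true
... | inj₂ _ = false

completeBipartite : ℕ → ℕ → Graph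
completeBipartite n m = record { V = n + m ; adj = λ i j → side n m i xor side n m j }

-- Vertices of μ(G): Fin (n + (n + 1)), with v_i = i, u_i = n + i, w = 2n.
data MVert (n : ℕ) : Set where
  vV : Fin n → MVert n
  uV : Fin n → MVert n
  wV : MVert n

classify : (n : ℕ) → Fin (n + (n + 1)) → MVert n
classify n i with splitAt n i
... | inj₁ a = vV a
... | inj₂ b with splitAt n b
...   | inj₁ c = uV c
...   | inj₂ _ = wV

mycAdj : (G : Graph) → MVert (V G) → MVert (V G) → Bool
mycAdj G (vV i) (vV j) = adj G i j
mycAdj G (uV i) (vV j) = adj G i j
mycAdj G (vV i) (uV j) = adj G j i
mycAdj G (uV _) wV     = true
mycAdj G wV     (uV _) = true
mycAdj G _      _      = false

mycielskian : Graph → Graph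
mycielskian G = record { V = V G + (V G + 1)
                       ; adj = λ i j → mycAdj G (classify (V G) i) (classify (V G) j) }

{-# OPTIONS --safe #-}
module Submission where

-- If any two vertices of G (equal or not) are joined by a walk of length 1 or 2, the same holds
-- in μ(G), so μ(G) has diameter at most 2 and H(μ(G), x) = d₁ x + d₂ x² with d₁ = |E(μ(G))|
-- and d₁ + d₂ = C(|V(μ(G))|, 2).  In μ(G) the vertex vᵢ has degree 2 deg vᵢ, uᵢ has degree
-- deg vᵢ + 1 and w has degree |V(G)|, whence |E(μ(G))| = 3 |E(G)| + |V(G)|.  The star Sₙ and
-- K_{n,m} satisfy the hypothesis and have n and n m edges respectively.

open import Defs
open import Data.Nat using (ℕ; zero; suc; _+_; _*_; _≤_; _<_; _<?_; s<s; s<s⁻¹)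
open import Data.Nat.Properties
  using (+-0-commutativeMonoid; +-assoc; +-identityʳ; *-identityʳ; <-asym; ≮⇒≥; ≤-antisym;
         +-cancelˡ-≡; +-cancelʳ-≡; *-cancelˡ-≡)
open import Data.Nat.Tactic.RingSolver using (solve-∀)
open import Algebra.Properties.CommutativeMonoid.Sum +-0-commutativeMonoid
  using (sum-syntax; sum-cong-≗; sum-replicate-zero; ∑-distrib-+; ∑-comm)
open import Data.Bool using (Bool; true; false; _∧_; _∨_; not; _xor_; if_then_else_)
open import Data.Bool.Properties using (∨-zeroʳ; ∧-zeroʳ; ∧-identityʳ; xor-comm; xor-same)
open import Data.Fin using (Fin; zero; suc; toℕ; _↑ˡ_; _↑ʳ_)
import Data.Fin as F
open import Data.Fin.Properties using (toℕ-injective; <⇒≢; splitAt-↑ˡ; splitAt-↑ʳ)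
open import Data.List using ([]; _∷_; allFin; tabulate)
open import Data.List.Membership.Propositional using (_∈_)
open import Data.List.Membership.Propositional.Properties using (∈-allFin)
open import Data.List.Relation.Unary.Any using (here; there)
open import Data.Product using (_×_; _,_; ∃-syntax)
open import Data.Sum using (_⊎_; inj₁; inj₂)
open import Data.Empty using (⊥-elim)
open import Function using (_∘_)
open import Relation.Nullary using (Dec; ¬_; yes; no)
open import Relation.Nullary.Decidable using (⌊_⌋; isYes≗does; dec-true; dec-false)
open import Relation.Binary.PropositionalEquality
  using (_≡_; _≢_; refl; sym; trans; cong; cong₂; module ≡-Reasoning)

⌊⌋-true : ∀ {A : Set} (a? : Dec A) → A → ⌊ a? ⌋ ≡ true
⌊⌋-true a? a = trans (isYes≗does a?) (dec-true a? a)

⌊⌋-false : ∀ {A : Set} (a? : Dec A) → ¬ A → ⌊ a? ⌋ ≡ false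
⌊⌋-false a? ¬a = trans (isYes≗does a?) (dec-false a? ¬a)

𝟙 : Bool → ℕ
𝟙 b = if b then 1 else 0

sumL-tabulate : ∀ {A : Set} {n} (f : A → ℕ) (g : Fin n → A) →
                sumL f (tabulate g) ≡ ∑[ i < n ] f (g i)
sumL-tabulate {n = zero}  f g = refl
sumL-tabulate {n = suc n} f g = cong (f (g zero) +_) (sumL-tabulate f (g ∘ suc))

countL-tabulate : ∀ {A : Set} {n} (p : A → Bool) (g : Fin n → A) →
                  countL p (tabulate g) ≡ ∑[ i < n ] 𝟙 (p (g i))
countL-tabulate {n = zero}  p g = refl
countL-tabulate {n = suc n} p g = cong (𝟙 (p (g zero)) +_) (countL-tabulate p (g ∘ suc))

∑-const : ∀ n c → ∑[ i < n ] c ≡ n * c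
∑-const zero    c = refl
∑-const (suc n) c = cong (c +_) (∑-const n c)

∑-one : ∀ n → ∑[ i < n ] 1 ≡ n
∑-one n = trans (∑-const n 1) (*-identityʳ n)

∑-↑ : ∀ a b (f : Fin (a + b) → ℕ) →
      ∑[ i < a + b ] f i ≡ ∑[ i < a ] f (i ↑ˡ b) + ∑[ j < b ] f (a ↑ʳ j)
∑-↑ zero    b f = refl
∑-↑ (suc a) b f = trans (cong (f zero +_) (∑-↑ a b (f ∘ suc))) (sym (+-assoc (f zero) _ _))

<?-suc : ∀ a b → ⌊ suc a <? suc b ⌋ ≡ ⌊ a <? b ⌋
<?-suc a b with suc a <? suc b | a <? b
... | yes _       | yes _   = refl
... | no  _       | no  _   = refl
... | no  1+a≮1+b | yes a<b = ⊥-elim (1+a≮1+b (s<s a<b))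
... | yes 1+a<1+b | no  a≮b = ⊥-elim (a≮b (s<s⁻¹ 1+a<1+b))

pairsWith : ∀ {N} → (Fin N → Fin N → Bool) → ℕ
pairsWith {N} P = ∑[ u < N ] ∑[ v < N ] 𝟙 (⌊ toℕ u <? toℕ v ⌋ ∧ P u v)

dG≡pairsWith-atDist : ∀ G k → dG G k ≡ pairsWith (atDist G k)
dG≡pairsWith-atDist G k =
  trans (sumL-tabulate (λ u → countL (counted u) (allFin (V G))) (λ u → u))
        (sum-cong-≗ λ u → countL-tabulate (counted u) (λ v → v))
  where
  counted : Fin (V G) → Fin (V G) → Bool
  counted u v = ⌊ toℕ u <? toℕ v ⌋ ∧ atDist G k u v

pairsWith-cong : ∀ {N} {P Q : Fin N → Fin N → Bool} →
                 (∀ {u v} → toℕ u < toℕ v → P u v ≡ Q u v) → pairsWith P ≡ pairsWith Q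
pairsWith-cong {P = P} {Q} P≡Q = sum-cong-≗ λ u → sum-cong-≗ λ v → cong 𝟙 (below u v)
  where
  below : ∀ u v → ⌊ toℕ u <? toℕ v ⌋ ∧ P u v ≡ ⌊ toℕ u <? toℕ v ⌋ ∧ Q u v
  below u v with toℕ u <? toℕ v
  ... | yes u<v = P≡Q u<v
  ... | no  _   = refl

pairsWith-false : ∀ N → pairsWith {N} (λ _ _ → false) ≡ 0
pairsWith-false N =
  trans (sum-cong-≗ {N} λ u → trans (sum-cong-≗ {N} λ v → cong 𝟙 (∧-zeroʳ ⌊ toℕ u <? toℕ v ⌋))
                                    (sum-replicate-zero N))
        (sum-replicate-zero N)

allPairs : ℕ → ℕ
allPairs N = pairsWith {N} (λ _ _ → true)

pairsWith-complement : ∀ {N} (P : Fin N → Fin N → Bool) →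
  pairsWith P + pairsWith (λ u v → not (P u v)) ≡ allPairs N
pairsWith-complement {N} P = trans (sym (∑-distrib-+ {N} _ _)) (sum-cong-≗ {N} λ u →
  trans (sym (∑-distrib-+ {N} _ _)) (sum-cong-≗ {N} λ v → 𝟙-complement ⌊ toℕ u <? toℕ v ⌋ (P u v)))
  where
  𝟙-complement : ∀ b p → 𝟙 (b ∧ p) + 𝟙 (b ∧ not p) ≡ 𝟙 (b ∧ true)
  𝟙-complement false _     = refl
  𝟙-complement true  false = refl
  𝟙-complement true  true  = refl

allPairs-suc : ∀ N → allPairs (suc N) ≡ N + allPairs N
allPairs-suc N = cong₂ _+_ (∑-one N) (sum-cong-≗ {N} λ u → sum-cong-≗ {N} λ v →
  cong (λ b → 𝟙 (b ∧ true)) (<?-suc (toℕ u) (toℕ v)))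

allPairs-twice : ∀ N → 2 * allPairs N + N ≡ N * N
allPairs-twice zero    = refl
allPairs-twice (suc N) = begin
  2 * allPairs (suc N) + suc N          ≡⟨ cong (λ t → 2 * t + suc N) (allPairs-suc N) ⟩
  2 * (N + allPairs N) + suc N          ≡⟨ shift N (allPairs N) ⟩
  (2 * allPairs N + N) + (2 * N + 1)    ≡⟨ cong (_+ (2 * N + 1)) (allPairs-twice N) ⟩
  N * N + (2 * N + 1)                   ≡⟨ square N ⟩
  suc N * suc N                         ∎
  where
  open ≡-Reasoning
  shift : ∀ N t → 2 * (N + t) + suc N ≡ (2 * t + N) + (2 * N + 1)
  shift = solve-∀
  square : ∀ N → N * N + (2 * N + 1) ≡ suc N * suc N
  square = solve-∀

𝟙-split : ∀ {N} (P : Fin N → Fin N → Bool) → (∀ u → P u u ≡ false) → ∀ u v →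
  𝟙 (P u v) ≡ 𝟙 (⌊ toℕ u <? toℕ v ⌋ ∧ P u v) + 𝟙 (⌊ toℕ v <? toℕ u ⌋ ∧ P u v)
𝟙-split P irrefl u v with toℕ u <? toℕ v | toℕ v <? toℕ u
... | yes u<v | yes v<u = ⊥-elim (<-asym u<v v<u)
... | yes _   | no  _   = sym (+-identityʳ _)
... | no  _   | yes _   = refl
... | no  u≮v | no  v≮u with toℕ-injective (≤-antisym (≮⇒≥ v≮u) (≮⇒≥ u≮v))
... | refl rewrite irrefl u = refl

pairsWith-double : ∀ {N} (P : Fin N → Fin N → Bool) →
  (∀ u v → P u v ≡ P v u) → (∀ u → P u u ≡ false) →
  2 * pairsWith P ≡ ∑[ u < N ] ∑[ v < N ] 𝟙 (P u v)
pairsWith-double {N} P sym-P irrefl-P = sym (begin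
  ∑[ u < N ] ∑[ v < N ] 𝟙 (P u v)
    ≡⟨ sum-cong-≗ {N} (λ u → trans (sum-cong-≗ {N} (𝟙-split P irrefl-P u))
                                    (∑-distrib-+ {N} (below u) (above u))) ⟩
  ∑[ u < N ] (∑[ v < N ] below u v + ∑[ v < N ] above u v)
    ≡⟨ ∑-distrib-+ {N} (λ u → ∑[ v < N ] below u v) (λ u → ∑[ v < N ] above u v) ⟩
  pairsWith P + ∑[ u < N ] ∑[ v < N ] above u v
    ≡⟨ cong (pairsWith P +_) (∑-comm {N} {N} above) ⟩
  pairsWith P + ∑[ v < N ] ∑[ u < N ] above u v
    ≡⟨ cong (pairsWith P +_) (sum-cong-≗ {N} λ v → sum-cong-≗ {N} λ u →
         cong (λ b → 𝟙 (⌊ toℕ v <? toℕ u ⌋ ∧ b)) (sym-P u v)) ⟩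
  pairsWith P + pairsWith P
    ≡⟨ cong (pairsWith P +_) (sym (+-identityʳ (pairsWith P))) ⟩
  2 * pairsWith P ∎)
  where
  open ≡-Reasoning
  below above : Fin N → Fin N → ℕ
  below u v = 𝟙 (⌊ toℕ u <? toℕ v ⌋ ∧ P u v)
  above u v = 𝟙 (⌊ toℕ v <? toℕ u ⌋ ∧ P u v)

record IsSimple (G : Graph) : Set where
  field
    adj-sym    : ∀ i j → adj G i j ≡ adj G j i
    adj-irrefl : ∀ i → adj G i i ≡ false
open IsSimple

degree : (G : Graph) → Fin (V G) → ℕ
degree G i = ∑[ j < V G ] 𝟙 (adj G i j)

degreeSum : Graph → ℕ
degreeSum G = ∑[ i < V G ] degree G i

-- For a = b this says that a is not isolated.
Walk₁₂ : {X : Set} → (X → X → Bool) → X → X → Set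
Walk₁₂ R a b = R a b ≡ true ⊎ ∃[ c ] (R a c ≡ true × R c b ≡ true)

Diameter≤2 : Graph → Set
Diameter≤2 G = ∀ u v → within G 2 u v ≡ true

anyL-true : ∀ {A : Set} (p : A → Bool) {x} xs → x ∈ xs → p x ≡ true → anyL p xs ≡ true
anyL-true p (y ∷ xs) (here refl) px = cong (_∨ anyL p xs) px
anyL-true p (y ∷ xs) (there x∈xs) px =
  trans (cong (p y ∨_) (anyL-true p xs x∈xs px)) (∨-zeroʳ (p y))

anyL-false : ∀ {A : Set} (p : A → Bool) → (∀ x → p x ≡ false) → ∀ xs → anyL p xs ≡ false
anyL-false p p≡false []       = refl
anyL-false p p≡false (x ∷ xs) = trans (cong (_∨ anyL p xs) (p≡false x)) (anyL-false p p≡false xs)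

anyL-select : ∀ {n} (f : Fin n → Bool) v → anyL (λ w → f w ∧ ⌊ w F.≟ v ⌋) (allFin n) ≡ f v
anyL-select {n} f v with f v in fv
... | true  = anyL-true _ (allFin n) (∈-allFin v) (cong₂ _∧_ fv (⌊⌋-true (v F.≟ v) refl))
... | false = anyL-false _ only-v (allFin n)
  where
  only-v : ∀ w → f w ∧ ⌊ w F.≟ v ⌋ ≡ false
  only-v w with w F.≟ v
  ... | yes refl = trans (∧-identityʳ (f w)) fv
  ... | no  _    = ∧-zeroʳ (f w)

module _ (G : Graph) where

  within-refl : ∀ v → within G 0 v v ≡ true
  within-refl v = ⌊⌋-true (v F.≟ v) refl

  within-suc : ∀ k {u v} → within G k u v ≡ true → within G (suc k) u v ≡ true
  within-suc k uv rewrite uv = refl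

  within-step : ∀ k {u w v} → adj G u w ≡ true → within G k w v ≡ true →
                within G (suc k) u v ≡ true
  within-step k {u} {w} {v} uw wv = trans
    (cong (within G k u v ∨_) (anyL-true _ (allFin (V G)) (∈-allFin w) (cong₂ _∧_ uw wv)))
    (∨-zeroʳ _)

  within-2 : ∀ {u v} → Walk₁₂ (adj G) u v → within G 2 u v ≡ true
  within-2 {v = v} (inj₁ uv)           = within-suc 1 (within-step 0 uv (within-refl v))
  within-2 {v = v} (inj₂ (w , uw , wv)) = within-step 1 uw (within-step 0 wv (within-refl v))

  within-1 : ∀ {u v} → u ≢ v → within G 1 u v ≡ adj G u v
  within-1 {u} {v} u≢v rewrite ⌊⌋-false (u F.≟ v) u≢v = anyL-select (adj G u) v

  atDist-1 : ∀ {u v} → u ≢ v → atDist G 1 u v ≡ adj G u v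
  atDist-1 {u} {v} u≢v = trans
    (cong₂ (λ a b → a ∧ not b) (within-1 u≢v) (⌊⌋-false (u F.≟ v) u≢v))
    (∧-identityʳ _)

  module _ (diam : Diameter≤2 G) where

    atDist-2 : ∀ {u v} → u ≢ v → atDist G 2 u v ≡ not (adj G u v)
    atDist-2 {u} {v} u≢v = cong₂ (λ a b → a ∧ not b) (diam u v) (within-1 u≢v)

    within-2+ : ∀ k {u v} → within G (2 + k) u v ≡ true
    within-2+ zero    = diam _ _
    within-2+ (suc k) = within-suc (2 + k) (within-2+ k)

    atDist-3+ : ∀ k {u v} → atDist G (3 + k) u v ≡ false
    atDist-3+ k {u} {v} rewrite within-2+ k {u} {v} = refl

    dG-1+dG-2 : dG G 1 + dG G 2 ≡ allPairs (V G)
    dG-1+dG-2 = begin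
      dG G 1 + dG G 2
        ≡⟨ cong₂ _+_ (dG≡pairsWith-atDist G 1) (dG≡pairsWith-atDist G 2) ⟩
      pairsWith (atDist G 1) + pairsWith (atDist G 2)
        ≡⟨ cong₂ _+_ (pairsWith-cong (atDist-1 ∘ <⇒≢)) (pairsWith-cong (atDist-2 ∘ <⇒≢)) ⟩
      pairsWith (adj G) + pairsWith (λ u v → not (adj G u v))
        ≡⟨ pairsWith-complement (adj G) ⟩
      allPairs (V G) ∎
      where open ≡-Reasoning

    dG-3+ : ∀ k → dG G (3 + k) ≡ 0
    dG-3+ k = begin
      dG G (3 + k)                     ≡⟨ dG≡pairsWith-atDist G (3 + k) ⟩
      pairsWith (atDist G (3 + k))     ≡⟨ pairsWith-cong (λ {u} {v} _ → atDist-3+ k {u} {v}) ⟩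
      pairsWith {V G} (λ _ _ → false)  ≡⟨ pairsWith-false (V G) ⟩
      0                                ∎
      where open ≡-Reasoning

  handshake : IsSimple G → 2 * dG G 1 ≡ degreeSum G
  handshake simple = begin
    2 * dG G 1                ≡⟨ cong (2 *_) (dG≡pairsWith-atDist G 1) ⟩
    2 * pairsWith (atDist G 1) ≡⟨ cong (2 *_) (pairsWith-cong (atDist-1 ∘ <⇒≢)) ⟩
    2 * pairsWith (adj G)      ≡⟨ pairsWith-double (adj G) (adj-sym simple) (adj-irrefl simple) ⟩
    degreeSum G                ∎
    where open ≡-Reasoning

hosoya-diameter≤2 : ∀ {H} (a b : ℕ) → IsSimple H → Diameter≤2 H →
  2 * a ≡ degreeSum H → 2 * (a + b) + V H ≡ V H * V H →
  ∀ k → hosoyaCoeff H k ≡ linQuad a b k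
hosoya-diameter≤2 {H} a b simple diam 2a≡degreeSum pairs-count = coefficient
  where
  d₁ : dG H 1 ≡ a
  d₁ = *-cancelˡ-≡ (dG H 1) a 2 (trans (handshake H simple) (sym 2a≡degreeSum))
  d₁+d₂ : dG H 1 + dG H 2 ≡ a + b
  d₁+d₂ = *-cancelˡ-≡ _ _ 2 (+-cancelʳ-≡ (V H) _ _ (begin
    2 * (dG H 1 + dG H 2) + V H ≡⟨ cong (λ t → 2 * t + V H) (dG-1+dG-2 H diam) ⟩
    2 * allPairs (V H) + V H   ≡⟨ allPairs-twice (V H) ⟩
    V H * V H                  ≡⟨ sym pairs-count ⟩
    2 * (a + b) + V H          ∎))
    where open ≡-Reasoning
  d₂ : dG H 2 ≡ b
  d₂ = +-cancelˡ-≡ a _ _ (trans (cong (_+ dG H 2) (sym d₁)) d₁+d₂)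
  coefficient : ∀ k → hosoyaCoeff H k ≡ linQuad a b k
  coefficient 0                   = refl
  coefficient 1                   = d₁
  coefficient 2                   = d₂
  coefficient (suc (suc (suc k))) = dG-3+ H diam k

Walk₁₂-comap : ∀ {X Y : Set} {R : Y → Y → Bool} (f : X → Y) {g : Y → X} →
  (∀ y → f (g y) ≡ y) → ∀ {x x′} → Walk₁₂ R (f x) (f x′) → Walk₁₂ (λ a b → R (f a) (f b)) x x′
Walk₁₂-comap f _ (inj₁ xx′) = inj₁ xx′
Walk₁₂-comap {R = R} f {g} f∘g≗id {x} {x′} (inj₂ (y , xy , yx′)) =
  inj₂ (g y , trans (cong (R (f x)) (f∘g≗id y)) xy
            , trans (cong (λ z → R z (f x′)) (f∘g≗id y)) yx′)

embed : ∀ N → MVert N → Fin (N + (N + 1))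
embed N (vV i) = i ↑ˡ (N + 1)
embed N (uV i) = N ↑ʳ (i ↑ˡ 1)
embed N wV     = N ↑ʳ (N ↑ʳ zero)

classify-embed : ∀ N a → classify N (embed N a) ≡ a
classify-embed N (vV i) rewrite splitAt-↑ˡ N i (N + 1) = refl
classify-embed N (uV i) rewrite splitAt-↑ʳ N (N + 1) (i ↑ˡ 1) | splitAt-↑ˡ N i 1 = refl
classify-embed N wV     rewrite splitAt-↑ʳ N (N + 1) (N ↑ʳ zero) | splitAt-↑ʳ N 1 zero = refl

∑-classify : ∀ N (f : MVert N → ℕ) →
  ∑[ x < N + (N + 1) ] f (classify N x) ≡ ∑[ i < N ] f (vV i) + (∑[ i < N ] f (uV i) + f wV)
∑-classify N f = trans (∑-↑ N (N + 1) _) (cong₂ _+_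
  (sum-cong-≗ {N} (cong f ∘ classify-embed N ∘ vV))
  (trans (∑-↑ N 1 _) (cong₂ _+_
    (sum-cong-≗ {N} (cong f ∘ classify-embed N ∘ uV))
    (trans (+-identityʳ _) (cong f (classify-embed N wV))))))

module _ {G : Graph} (simple : IsSimple G) where

  private
    N : ℕ
    N = V G
    μG : Graph
    μG = mycielskian G

  mycAdj-sym : ∀ a b → mycAdj G a b ≡ mycAdj G b a
  mycAdj-sym (vV i) (vV j) = adj-sym simple i j
  mycAdj-sym (vV i) (uV j) = refl
  mycAdj-sym (vV i) wV     = refl
  mycAdj-sym (uV i) (vV j) = refl
  mycAdj-sym (uV i) (uV j) = refl
  mycAdj-sym (uV i) wV     = refl
  mycAdj-sym wV     (vV j) = refl
  mycAdj-sym wV     (uV j) = refl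
  mycAdj-sym wV     wV     = refl

  mycAdj-irrefl : ∀ a → mycAdj G a a ≡ false
  mycAdj-irrefl (vV i) = adj-irrefl simple i
  mycAdj-irrefl (uV i) = refl
  mycAdj-irrefl wV     = refl

  mycielskian-isSimple : IsSimple μG
  mycielskian-isSimple = record
    { adj-sym    = λ x y → mycAdj-sym (classify N x) (classify N y)
    ; adj-irrefl = λ x → mycAdj-irrefl (classify N x)
    }

  walk-v-u : ∀ {i j} → Walk₁₂ (adj G) i j → Walk₁₂ (mycAdj G) (vV i) (uV j)
  walk-v-u (inj₁ ij)            = inj₁ (trans (adj-sym simple _ _) ij)
  walk-v-u (inj₂ (k , ik , kj)) = inj₂ (vV k , ik , trans (adj-sym simple _ _) kj)

  walk-to-v : ∀ a {i j} → (∀ k → mycAdj G a (vV k) ≡ adj G i k) →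
              Walk₁₂ (adj G) i j → Walk₁₂ (mycAdj G) a (vV j)
  walk-to-v a a~i (inj₁ ij)            = inj₁ (trans (a~i _) ij)
  walk-to-v a a~i (inj₂ (k , ik , kj)) = inj₂ (vV k , trans (a~i k) ik , kj)

  module _ (walk : ∀ i j → Walk₁₂ (adj G) i j) where

    neighbour : ∀ i → ∃[ k ] (adj G k i ≡ true)
    neighbour i with walk i i
    ... | inj₁ ii           = i , ii
    ... | inj₂ (k , _ , ki) = k , ki

    -- The vertex v₀ only serves to join w to itself, through u(v₀).
    mycAdj-walk₁₂ : Fin N → ∀ a b → Walk₁₂ (mycAdj G) a b
    mycAdj-walk₁₂ v₀ (vV i) (vV j) = walk-to-v (vV i) (λ _ → refl) (walk i j)
    mycAdj-walk₁₂ v₀ (vV i) (uV j) = walk-v-u (walk i j)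
    mycAdj-walk₁₂ v₀ (vV i) wV     = let (k , ki) = neighbour i in inj₂ (uV k , ki , refl)
    mycAdj-walk₁₂ v₀ (uV i) (vV j) = walk-to-v (uV i) (λ _ → refl) (walk i j)
    mycAdj-walk₁₂ v₀ (uV i) (uV j) = inj₂ (wV , refl , refl)
    mycAdj-walk₁₂ v₀ (uV i) wV     = inj₁ refl
    mycAdj-walk₁₂ v₀ wV     (vV j) = let (k , kj) = neighbour j in inj₂ (uV k , refl , kj)
    mycAdj-walk₁₂ v₀ wV     (uV j) = inj₁ refl
    mycAdj-walk₁₂ v₀ wV     wV     = inj₂ (uV v₀ , refl , refl)

    mycielskian-diameter≤2 : Fin N → Diameter≤2 μG
    mycielskian-diameter≤2 v₀ x y = within-2 μG (Walk₁₂-comap {R = mycAdj G}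
      (classify N) (classify-embed N) (mycAdj-walk₁₂ v₀ (classify N x) (classify N y)))

  mycielskian-degreeSum : degreeSum μG ≡ 3 * degreeSum G + 2 * N
  mycielskian-degreeSum = begin
    degreeSum μG
      ≡⟨ ∑-classify N myc-degree ⟩
    ∑[ i < N ] myc-degree (vV i) + (∑[ i < N ] myc-degree (uV i) + myc-degree wV)
      ≡⟨ cong₂ _+_ (sum-cong-≗ {N} degree-v) (cong₂ _+_ (sum-cong-≗ {N} degree-u) degree-w) ⟩
    ∑[ i < N ] (degree G i + degree G i) + (∑[ i < N ] (degree G i + 1) + N)
      ≡⟨ cong₂ _+_ (∑-distrib-+ {N} (degree G) (degree G))
                   (cong (_+ N) (trans (∑-distrib-+ {N} (degree G) (λ _ → 1))
                                       (cong (degreeSum G +_) (∑-one N)))) ⟩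
    (degreeSum G + degreeSum G) + ((degreeSum G + N) + N)
      ≡⟨ collect (degreeSum G) N ⟩
    3 * degreeSum G + 2 * N ∎
    where
    open ≡-Reasoning
    myc-degree : MVert N → ℕ
    myc-degree a = ∑[ y < N + (N + 1) ] 𝟙 (mycAdj G a (classify N y))
    degree-v : ∀ i → myc-degree (vV i) ≡ degree G i + degree G i
    degree-v i = trans (∑-classify N (𝟙 ∘ mycAdj G (vV i))) (cong (degree G i +_)
      (trans (+-identityʳ _) (sum-cong-≗ {N} λ j → cong 𝟙 (adj-sym simple j i))))
    degree-u : ∀ i → myc-degree (uV i) ≡ degree G i + 1
    degree-u i = trans (∑-classify N (𝟙 ∘ mycAdj G (uV i)))
      (cong (λ s → degree G i + (s + 1)) (sum-replicate-zero N))
    degree-w : myc-degree wV ≡ N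
    degree-w = trans (∑-classify N (𝟙 ∘ mycAdj G wV))
      (cong₂ _+_ (sum-replicate-zero N) (trans (+-identityʳ _) (∑-one N)))
    collect : ∀ s n → (s + s) + ((s + n) + n) ≡ 3 * s + 2 * n
    collect = solve-∀

hosoya-mycielskian : ∀ {G} (e a b : ℕ) → IsSimple G → (∀ i j → Walk₁₂ (adj G) i j) → Fin (V G) →
  degreeSum G ≡ 2 * e → a ≡ 3 * e + V G →
  2 * (a + b) + (V G + (V G + 1)) ≡ (V G + (V G + 1)) * (V G + (V G + 1)) →
  ∀ k → hosoyaCoeff (mycielskian G) k ≡ linQuad a b k
hosoya-mycielskian {G} e a b simple walk v₀ edges a≡3e+N pairs-count =
  hosoya-diameter≤2 a b (mycielskian-isSimple simple) (mycielskian-diameter≤2 simple walk v₀)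
    (begin
      2 * a                         ≡⟨ cong (2 *_) a≡3e+N ⟩
      2 * (3 * e + V G)             ≡⟨ regroup e (V G) ⟩
      3 * (2 * e) + 2 * V G         ≡⟨ cong (λ s → 3 * s + 2 * V G) edges ⟨
      3 * degreeSum G + 2 * V G     ≡⟨ mycielskian-degreeSum simple ⟨
      degreeSum (mycielskian G)     ∎)
    pairs-count
  where
  open ≡-Reasoning
  regroup : ∀ e n → 2 * (3 * e + n) ≡ 3 * (2 * e) + 2 * n
  regroup = solve-∀

star-isSimple : ∀ n → IsSimple (star n)
star-isSimple n = record { adj-sym = adj-sym′ ; adj-irrefl = adj-irrefl′ }
  where
  adj-sym′ : ∀ i j → adj (star n) i j ≡ adj (star n) j i
  adj-sym′ zero    zero    = refl
  adj-sym′ zero    (suc j) = refl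
  adj-sym′ (suc i) zero    = refl
  adj-sym′ (suc i) (suc j) = refl
  adj-irrefl′ : ∀ i → adj (star n) i i ≡ false
  adj-irrefl′ zero    = refl
  adj-irrefl′ (suc i) = refl

star-walk₁₂ : ∀ n i j → Walk₁₂ (adj (star (suc n))) i j
star-walk₁₂ n zero    zero    = inj₂ (suc zero , refl , refl)
star-walk₁₂ n zero    (suc j) = inj₁ refl
star-walk₁₂ n (suc i) zero    = inj₁ refl
star-walk₁₂ n (suc i) (suc j) = inj₂ (zero , refl , refl)

star-degreeSum : ∀ n → degreeSum (star n) ≡ 2 * n
star-degreeSum n = trans
  (cong₂ _+_ (∑-one n) (trans (sum-cong-≗ {n} λ _ → cong suc (sum-replicate-zero n)) (∑-one n)))
  (cong (n +_) (sym (+-identityʳ n)))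

side-↑ˡ : ∀ n m i → side n m (i ↑ˡ m) ≡ true
side-↑ˡ n m i rewrite splitAt-↑ˡ n i m = refl

side-↑ʳ : ∀ n m j → side n m (n ↑ʳ j) ≡ false
side-↑ʳ n m j rewrite splitAt-↑ʳ n m j = refl

completeBipartite-isSimple : ∀ n m → IsSimple (completeBipartite n m)
completeBipartite-isSimple n m = record
  { adj-sym    = λ i j → xor-comm (side n m i) (side n m j)
  ; adj-irrefl = λ i → xor-same (side n m i)
  }

completeBipartite-walk₁₂ : ∀ n m i j → Walk₁₂ (adj (completeBipartite (suc n) (suc m))) i j
completeBipartite-walk₁₂ n m i j with side (suc n) (suc m) i | side (suc n) (suc m) j
... | true  | true  = inj₂ (suc n ↑ʳ zero , cong (true xor_) right , cong (_xor true) right)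
  where right = side-↑ʳ (suc n) (suc m) zero
... | true  | false = inj₁ refl
... | false | true  = inj₁ refl
... | false | false = inj₂ (zero ↑ˡ suc m , cong (false xor_) left , cong (_xor false) left)
  where left = side-↑ˡ (suc n) (suc m) zero

module _ (n m : ℕ) where

  private
    Kₙₘ : Graph
    Kₙₘ = completeBipartite n m

  completeBipartite-degree-↑ˡ : ∀ i → degree Kₙₘ (i ↑ˡ m) ≡ m
  completeBipartite-degree-↑ˡ i = trans (∑-↑ n m _) (cong₂ _+_
    (trans (sum-cong-≗ {n} λ i′ → cong 𝟙 (cong₂ _xor_ (side-↑ˡ n m i) (side-↑ˡ n m i′)))
           (sum-replicate-zero n))
    (trans (sum-cong-≗ {m} λ j → cong 𝟙 (cong₂ _xor_ (side-↑ˡ n m i) (side-↑ʳ n m j)))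
           (∑-one m)))

  completeBipartite-degree-↑ʳ : ∀ j → degree Kₙₘ (n ↑ʳ j) ≡ n
  completeBipartite-degree-↑ʳ j = trans (∑-↑ n m _) (trans (cong₂ _+_
    (trans (sum-cong-≗ {n} λ i → cong 𝟙 (cong₂ _xor_ (side-↑ʳ n m j) (side-↑ˡ n m i)))
           (∑-one n))
    (trans (sum-cong-≗ {m} λ j′ → cong 𝟙 (cong₂ _xor_ (side-↑ʳ n m j) (side-↑ʳ n m j′)))
           (sum-replicate-zero m)))
    (+-identityʳ n))

  completeBipartite-degreeSum : degreeSum Kₙₘ ≡ 2 * (n * m)
  completeBipartite-degreeSum = trans (∑-↑ n m _) (trans (cong₂ _+_
    (trans (sum-cong-≗ {n} completeBipartite-degree-↑ˡ) (∑-const n m))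
    (trans (sum-cong-≗ {m} completeBipartite-degree-↑ʳ) (∑-const m n)))
    (both-sides n m))
    where
    both-sides : ∀ n m → n * m + m * n ≡ 2 * (n * m)
    both-sides = solve-∀

corollary3p7 : (n m : ℕ) → 2 ≤ n → 2 ≤ m →
    ((k : ℕ) → hosoyaCoeff (mycielskian (star n)) k
                 ≡ linQuad (4 * n + 1) (2 * n * n + n + 2) k)
    × ((k : ℕ) → hosoyaCoeff (mycielskian (completeBipartite n m)) k
                 ≡ linQuad (3 * n * m + n + m) (2 * n * n + 2 * m * m + n * m) k)
corollary3p7 n@(suc n′) m@(suc m′) _ _ =
    hosoya-mycielskian n (4 * n + 1) (2 * n * n + n + 2)
      (star-isSimple n) (star-walk₁₂ n′) zero
      (star-degreeSum n) (star-d₁ n) (star-pairs n)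
  , hosoya-mycielskian (n * m) (3 * n * m + n + m) (2 * n * n + 2 * m * m + n * m)
      (completeBipartite-isSimple n m) (completeBipartite-walk₁₂ n′ m′) (zero ↑ˡ m)
      (completeBipartite-degreeSum n m) (bipartite-d₁ n m) (bipartite-pairs n m)
  where
  star-d₁ : ∀ n → 4 * n + 1 ≡ 3 * n + suc n
  star-d₁ = solve-∀
  star-pairs : ∀ n → let M = suc n + (suc n + 1) in
    2 * ((4 * n + 1) + (2 * n * n + n + 2)) + M ≡ M * M
  star-pairs = solve-∀
  bipartite-d₁ : ∀ n m → 3 * n * m + n + m ≡ 3 * (n * m) + (n + m)
  bipartite-d₁ = solve-∀
  bipartite-pairs : ∀ n m → let M = (n + m) + ((n + m) + 1) in
    2 * ((3 * n * m + n + m) + (2 * n * n + 2 * m * m + n * m)) + M ≡ M * M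
  bipartite-pairs = solve-∀
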